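{- Let $\mathbb{D}$ be a countable set, $S\subseteq\mathbb{D}$ a finite set and $n\in\mathbb{N}$. A function $H:S\times\mathbb{D}\to\mathbb{N}$ is a histogram over $S$ of degree $n$ if and only if $H$ is the (pointwise) sum of $n$ simple histograms over $S$.
   Context: A histogram over a finite set $S\subseteq\mathbb{D}$ is a total function $H:S\times\mathbb{D}\to\mathbb{N}$ for which there is $n\in\mathbb{N}$ (its degree) such that (1) $\sum_{\beta\in\mathbb{D}}H(\alpha,\beta)=n$ for every $\alpha\in S$, and (2) $\sum_{\alpha\in S}H(\alpha,\beta)\le n$ for every $\beta\in\mathbb{D}$. A histogram of degree $1$ is called simple. Histograms over the same $S$ are summed pointwise. -}

module Defs where

open import Data.Nat using (ℕ; zero; suc; _+_; _≤_)
open import Data.Fin using (Fin; zero; suc)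
open import Data.List using (List; map)
open import Data.Nat.ListAction using (sum)
open import Data.List.Membership.Propositional using (_∉_)
open import Data.List.Relation.Unary.Unique.Propositional using (Unique)
open import Data.Product using (Σ; _×_; ∃-syntax)
open import Relation.Binary.PropositionalEquality using (_≡_)
open import Function.Definitions using (Injective)

record Countable (D : Set) : Set where
  field
    enc     : D → ℕ
    enc-inj : Injective _≡_ _≡_ enc

record FinSubset (D : Set) : Set where
  field
    card  : ℕ
    elem  : Fin card → D
    elem-inj : Injective _≡_ _≡_ elem

open FinSubset public

sumFin : (k : ℕ) → (Fin k → ℕ) → ℕ
sumFin zero    f = 0
sumFin (suc k) f = f zero + sumFin k (λ i → f (suc i))

-- (Possibly infinite) sum over D of a ℕ-valued function equals m:
-- f has finite support contained in a duplicate-free list L, and the sum over L is m.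
SumsTo : {D : Set} → (D → ℕ) → ℕ → Set
SumsTo {D} f m =
  ∃[ L ] (Unique L × (∀ β → β ∉ L → f β ≡ 0) × (sum (map f L) ≡ m))

-- A function H : S × D → ℕ (rows indexed by the elements of S).
Fun : {D : Set} → FinSubset D → Set
Fun {D} S = Fin (card S) → D → ℕ

IsHistogram : {D : Set} (S : FinSubset D) → Fun S → ℕ → Set
IsHistogram {D} S H n =
  (∀ (α : Fin (card S)) → SumsTo (H α) n) ×
  (∀ (β : D) → sumFin (card S) (λ α → H α β) ≤ n)

IsSimple : {D : Set} (S : FinSubset D) → Fun S → Set
IsSimple S H = IsHistogram S H 1

SumOfSimple : {D : Set} (S : FinSubset D) → Fun S → ℕ → Set
SumOfSimple S H n =
  Σ (Fin n → Fun S) λ Hs →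
    (∀ i → IsSimple S (Hs i)) ×
    (∀ α β → H α β ≡ sumFin n (λ i → Hs i α β))

module Submission where

-- H : S × D → ℕ is read as the adjacency matrix of a bipartite multigraph between the
-- rows S and the columns D.  The easy direction: a simple histogram puts a unit mass in
-- every row and at most one unit in every column, so a sum of n of them has row mass n
-- and column mass at most n.  The other direction is König's edge-colouring theorem: a
-- bipartite multigraph of maximum degree n is a union of n matchings.  It is proved by
-- adding the edges one at a time to a proper colouring with n colours: for a new edge
-- (α , β) some colour a is free at α and some colour b is free at β, and if a is used at
-- β, swapping a and b along the a/b-alternating path through β (a Kempe chain) frees it.
-- As every row of a histogram has degree exactly n, every colour class then meets every
-- row, i.e. it is a perfect matching of S into D, which is a simple histogram.

open import Defs
open import Data.Nat using (ℕ; zero; suc; _+_; _∸_; _≤_; _<_; z≤n; s≤s; z<s; _<?_) renaming (_≟_ to _≟ℕ_)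
open import Data.Nat.Properties hiding (_≟_)
open import Data.Nat.ListAction using (sum)
open import Data.Fin using (Fin; zero; suc; toℕ; fromℕ<)
import Data.Fin.Properties as FP
open import Data.Fin.Permutation using (transpose)
import Data.Fin.Permutation.Components as PC
open import Data.List using (List; []; _∷_; map; tabulate; deduplicate)
open import Data.List.Membership.Propositional using (_∈_; _∉_)
open import Data.List.Membership.Propositional.Properties using (∈-tabulate⁺; ∈-deduplicate⁺)
import Data.List.Membership.DecPropositional as DecMembership
open import Data.List.Relation.Unary.All using (All; []; _∷_)
open import Data.List.Relation.Unary.Any using (here; there)
open import Data.List.Relation.Unary.Unique.Propositional using (Unique; []; _∷_)
open import Data.List.Relation.Unary.Unique.DecPropositional.Properties using (deduplicate-!)
open import Data.Product using (Σ; _×_; _,_; proj₁; proj₂; ∃-syntax)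
open import Data.Maybe using (Maybe; just; nothing; _>>=_)
open import Data.Maybe.Properties using (just-injective; ≡-dec)
open import Data.Sum using (_⊎_; inj₁; inj₂)
open import Data.Empty using (⊥-elim)
open import Relation.Nullary using (Dec; yes; no; ¬_)
open import Relation.Binary.Definitions using (DecidableEquality)
open import Relation.Binary.PropositionalEquality
open import Function.Base using (_∘_)
open import Function.Definitions using (Injective)
open import Function.Bundles using (_⇔_; mk⇔; mk↣)
import Algebra.Properties.CommutativeMonoid.Sum as CMSum
open CMSum +-0-commutativeMonoid using (∑-distrib-+; ∑-comm; ∑-permute) renaming (sum to ∑)

sumFin≡∑ : ∀ k (f : Fin k → ℕ) → sumFin k f ≡ ∑ f
sumFin≡∑ zero    f = refl
sumFin≡∑ (suc k) f = cong (f zero +_) (sumFin≡∑ k (f ∘ suc))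

sumFin-cong : ∀ k {f g : Fin k → ℕ} → (∀ i → f i ≡ g i) → sumFin k f ≡ sumFin k g
sumFin-cong zero    f≗g = refl
sumFin-cong (suc k) f≗g = cong₂ _+_ (f≗g zero) (sumFin-cong k (f≗g ∘ suc))

sumFin-zero : ∀ k {f : Fin k → ℕ} → (∀ i → f i ≡ 0) → sumFin k f ≡ 0
sumFin-zero zero    f≗0 = refl
sumFin-zero (suc k) f≗0 = cong₂ _+_ (f≗0 zero) (sumFin-zero k (f≗0 ∘ suc))

sumFin-ones : ∀ k → sumFin k (λ _ → 1) ≡ k
sumFin-ones zero    = refl
sumFin-ones (suc k) = cong suc (sumFin-ones k)

sumFin-mono : ∀ k {f g : Fin k → ℕ} → (∀ i → f i ≤ g i) → sumFin k f ≤ sumFin k g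
sumFin-mono zero    f≤g = z≤n
sumFin-mono (suc k) f≤g = +-mono-≤ (f≤g zero) (sumFin-mono k (f≤g ∘ suc))

sumFin-strict : ∀ k {f g : Fin k → ℕ} → (∀ i → f i ≤ g i) →
                ∀ j → f j < g j → sumFin k f < sumFin k g
sumFin-strict (suc k) f≤g zero    fj<gj = +-mono-<-≤ fj<gj (sumFin-mono k (f≤g ∘ suc))
sumFin-strict (suc k) f≤g (suc j) fj<gj = +-mono-≤-< (f≤g zero) (sumFin-strict k (f≤g ∘ suc) j fj<gj)

sumFin-term : ∀ k (f : Fin k → ℕ) i → f i ≤ sumFin k f
sumFin-term (suc k) f zero    = m≤m+n _ _
sumFin-term (suc k) f (suc i) = ≤-trans (sumFin-term k (f ∘ suc) i) (m≤n+m _ _)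

sumFin-≤-ones : ∀ k {f : Fin k → ℕ} → (∀ i → f i ≤ 1) → sumFin k f ≤ k
sumFin-≤-ones k {f} f≤1 = subst (sumFin k f ≤_) (sumFin-ones k) (sumFin-mono k f≤1)

sumFin-all-ones : ∀ k {f : Fin k → ℕ} → (∀ i → f i ≤ 1) → sumFin k f ≡ k → ∀ i → f i ≡ 1
sumFin-all-ones k {f} f≤1 sum≡k i = ≤-antisym (f≤1 i) (≮⇒≥ λ fi<1 →
  <-irrefl refl (subst₂ _<_ sum≡k (sumFin-ones k) (sumFin-strict k f≤1 i fi<1)))

sumFin-<-zero-term : ∀ k (f : Fin k → ℕ) → sumFin k f < k → ∃[ i ] f i ≡ 0
sumFin-<-zero-term k f sum<k with FP.any? (λ i → f i ≟ℕ 0)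
... | yes found = found
... | no  none  = ⊥-elim (<⇒≱ sum<k
  (subst (_≤ sumFin k f) (sumFin-ones k) (sumFin-mono k (λ i → n≢0⇒n>0 (λ fi≡0 → none (i , fi≡0))))))

sumFin-positive-term : ∀ k (f : Fin k → ℕ) → 0 < sumFin k f → ∃[ i ] 0 < f i
sumFin-positive-term k f 0<sum with FP.any? (λ i → 0 <? f i)
... | yes found = found
... | no  none  = ⊥-elim (<-irrefl (sym (sumFin-zero k (λ i → n≤0⇒n≡0 (≮⇒≥ (λ 0<fi → none (i , 0<fi)))))) 0<sum)

sumFin-update : ∀ k (f g : Fin k → ℕ) (a : Fin k) c → g a ≡ f a + c → (∀ i → i ≢ a → g i ≡ f i) →
                sumFin k g ≡ sumFin k f + c
sumFin-update (suc k) f g zero c ga eq = begin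
  g zero + sumFin k (g ∘ suc)   ≡⟨ cong₂ _+_ ga (sumFin-cong k (λ i → eq (suc i) λ ())) ⟩
  f zero + c + sumFin k (f ∘ suc) ≡⟨ +-assoc (f zero) c _ ⟩
  f zero + (c + sumFin k (f ∘ suc)) ≡⟨ cong (f zero +_) (+-comm c _) ⟩
  f zero + (sumFin k (f ∘ suc) + c) ≡⟨ +-assoc (f zero) _ c ⟨
  f zero + sumFin k (f ∘ suc) + c ∎
  where open ≡-Reasoning
sumFin-update (suc k) f g (suc a) c ga eq = begin
  g zero + sumFin k (g ∘ suc)       ≡⟨ cong₂ _+_ (eq zero λ ()) (sumFin-update k (f ∘ suc) (g ∘ suc) a c ga
                                          (λ i i≢a → eq (suc i) (i≢a ∘ FP.suc-injective))) ⟩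
  f zero + (sumFin k (f ∘ suc) + c) ≡⟨ +-assoc (f zero) _ c ⟨
  f zero + sumFin k (f ∘ suc) + c ∎
  where open ≡-Reasoning

sumFin-distrib : ∀ k (f g : Fin k → ℕ) → sumFin k (λ i → f i + g i) ≡ sumFin k f + sumFin k g
sumFin-distrib k f g = begin
  sumFin k (λ i → f i + g i) ≡⟨ sumFin≡∑ k _ ⟩
  ∑ (λ i → f i + g i)        ≡⟨ ∑-distrib-+ f g ⟩
  ∑ f + ∑ g                  ≡⟨ cong₂ _+_ (sumFin≡∑ k f) (sumFin≡∑ k g) ⟨
  sumFin k f + sumFin k g    ∎
  where open ≡-Reasoning

sumFin-comm : ∀ m n (f : Fin m → Fin n → ℕ) →
              sumFin m (λ i → sumFin n (f i)) ≡ sumFin n (λ j → sumFin m (λ i → f i j))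
sumFin-comm m n f = begin
  sumFin m (λ i → sumFin n (f i))         ≡⟨ sumFin-cong m (λ i → sumFin≡∑ n (f i)) ⟩
  sumFin m (λ i → ∑ (f i))                ≡⟨ sumFin≡∑ m _ ⟩
  ∑ (λ i → ∑ (f i))                       ≡⟨ ∑-comm f ⟩
  ∑ (λ j → ∑ (λ i → f i j))               ≡⟨ sumFin≡∑ n _ ⟨
  sumFin n (λ j → ∑ (λ i → f i j))        ≡⟨ sumFin-cong n (λ j → sumFin≡∑ m _) ⟨
  sumFin n (λ j → sumFin m (λ i → f i j)) ∎
  where open ≡-Reasoning

sumFin-transpose : ∀ k (a b : Fin k) (f : Fin k → ℕ) → sumFin k (f ∘ PC.transpose a b) ≡ sumFin k f
sumFin-transpose k a b f = begin
  sumFin k (f ∘ PC.transpose a b) ≡⟨ sumFin≡∑ k _ ⟩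
  ∑ (f ∘ PC.transpose a b)        ≡⟨ ∑-permute f (transpose a b) ⟨
  ∑ f                             ≡⟨ sumFin≡∑ k f ⟨
  sumFin k f                      ∎
  where open ≡-Reasoning

listSum : {A : Set} → List A → (A → ℕ) → ℕ
listSum L f = sum (map f L)

listSum-cong : {A : Set} (L : List A) {f g : A → ℕ} → (∀ x → f x ≡ g x) → listSum L f ≡ listSum L g
listSum-cong []      f≗g = refl
listSum-cong (x ∷ L) f≗g = cong₂ _+_ (f≗g x) (listSum-cong L f≗g)

listSum-zero : {A : Set} (L : List A) {f : A → ℕ} → (∀ x → f x ≡ 0) → listSum L f ≡ 0
listSum-zero []      f≗0 = refl
listSum-zero (x ∷ L) f≗0 = cong₂ _+_ (f≗0 x) (listSum-zero L f≗0)

listSum-mono : {A : Set} (L : List A) {f g : A → ℕ} → (∀ x → f x ≤ g x) → listSum L f ≤ listSum L g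
listSum-mono []      f≤g = z≤n
listSum-mono (x ∷ L) f≤g = +-mono-≤ (f≤g x) (listSum-mono L f≤g)

listSum-strict : {A : Set} (L : List A) {f g : A → ℕ} → (∀ x → f x ≤ g x) →
                 ∀ {y} → y ∈ L → f y < g y → listSum L f < listSum L g
listSum-strict (x ∷ L) f≤g (here refl) fy<gy = +-mono-<-≤ fy<gy (listSum-mono L f≤g)
listSum-strict (x ∷ L) f≤g (there y∈) fy<gy = +-mono-≤-< (f≤g x) (listSum-strict L f≤g y∈ fy<gy)

listSum-term : {A : Set} (L : List A) (f : A → ℕ) {y : A} → y ∈ L → f y ≤ listSum L f
listSum-term (x ∷ L) f (here refl) = m≤m+n _ _
listSum-term (x ∷ L) f (there y∈) = ≤-trans (listSum-term L f y∈) (m≤n+m _ _)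

listSum-two-terms : {A : Set} (L : List A) (f : A → ℕ) {y z : A} → y ∈ L → z ∈ L → y ≢ z →
                    f y + f z ≤ listSum L f
listSum-two-terms (x ∷ L) f (here refl) (here refl) y≢z = ⊥-elim (y≢z refl)
listSum-two-terms (x ∷ L) f (here refl) (there z∈) y≢z = +-monoʳ-≤ (f x) (listSum-term L f z∈)
listSum-two-terms (x ∷ L) f (there y∈) (here refl) y≢z =
  subst (_≤ f x + listSum L f) (+-comm (f x) _) (+-monoʳ-≤ (f x) (listSum-term L f y∈))
listSum-two-terms (x ∷ L) f (there y∈) (there z∈) y≢z = ≤-trans (listSum-two-terms L f y∈ z∈ y≢z) (m≤n+m _ _)

listSum-positive-term : {A : Set} (L : List A) (f : A → ℕ) → 0 < listSum L f → ∃[ y ] (y ∈ L × 0 < f y)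
listSum-positive-term (x ∷ L) f 0<sum with 0 <? f x
... | yes 0<fx = x , here refl , 0<fx
... | no  fx≯0 with listSum-positive-term L f (subst (λ t → 0 < t + listSum L f) (n≤0⇒n≡0 (≮⇒≥ fx≯0)) 0<sum)
...   | y , y∈ , 0<fy = y , there y∈ , 0<fy

listSum-sumFin : {A : Set} (L : List A) (n : ℕ) (g : Fin n → A → ℕ) →
                 listSum L (λ y → sumFin n (λ i → g i y)) ≡ sumFin n (λ i → listSum L (g i))
listSum-sumFin []      n g = sym (sumFin-zero n (λ _ → refl))
listSum-sumFin (x ∷ L) n g = begin
  sumFin n (λ i → g i x) + listSum L (λ y → sumFin n (λ i → g i y))
    ≡⟨ cong (sumFin n (λ i → g i x) +_) (listSum-sumFin L n g) ⟩
  sumFin n (λ i → g i x) + sumFin n (λ i → listSum L (g i))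
    ≡⟨ sumFin-distrib n (λ i → g i x) (λ i → listSum L (g i)) ⟨
  sumFin n (λ i → g i x + listSum L (g i)) ∎
  where open ≡-Reasoning

module PointMass {A : Set} (_≟_ : DecidableEquality A) where

  open DecMembership _≟_ using (_∈?_)

  pt : A → A → ℕ
  pt d y with d ≟ y
  ... | yes _ = 1
  ... | no  _ = 0

  pt-self : ∀ d → pt d d ≡ 1
  pt-self d with d ≟ d
  ... | yes _   = refl
  ... | no  d≢d = ⊥-elim (d≢d refl)

  pt-elsewhere : ∀ {d y} → d ≢ y → pt d y ≡ 0
  pt-elsewhere {d} {y} d≢y with d ≟ y
  ... | yes d≡y = ⊥-elim (d≢y d≡y)
  ... | no  _   = refl

  pt-≤1 : ∀ d y → pt d y ≤ 1
  pt-≤1 d y with d ≟ y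
  ... | yes _ = ≤-refl
  ... | no  _ = z≤n

  listSum-pt-≤1 : ∀ d (L : List A) → Unique L → listSum L (pt d) ≤ 1
  listSum-pt-≤1 d []      []           = z≤n
  listSum-pt-≤1 d (y ∷ L) (y∉L ∷ uniq) with d ≟ y
  ... | yes refl = ≤-reflexive (cong suc (listSum-zero-off L y∉L))
    where
    listSum-zero-off : ∀ L → All (d ≢_) L → listSum L (pt d) ≡ 0
    listSum-zero-off []      []           = refl
    listSum-zero-off (z ∷ L) (d≢z ∷ d∉L) = cong₂ _+_ (pt-elsewhere d≢z) (listSum-zero-off L d∉L)
  ... | no  _    = listSum-pt-≤1 d L uniq

  listSum-pt-∈ : ∀ d (L : List A) → Unique L → d ∈ L → listSum L (pt d) ≡ 1
  listSum-pt-∈ d L uniq d∈L =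
    ≤-antisym (listSum-pt-≤1 d L uniq) (subst (_≤ listSum L (pt d)) (pt-self d) (listSum-term L (pt d) d∈L))

  pt-sumsTo-1 : ∀ d → SumsTo (pt d) 1
  pt-sumsTo-1 d = d ∷ [] , [] ∷ [] , (λ y y∉ → pt-elsewhere (λ d≡y → y∉ (here (sym d≡y)))) , cong (_+ 0) (pt-self d)

  sumsTo-1⇒pt : (f : A → ℕ) → SumsTo f 1 → Σ A λ d → ∀ y → f y ≡ pt d y
  sumsTo-1⇒pt f (L , _ , off-L , sum≡1) with listSum-positive-term L f (subst (0 <_) (sym sum≡1) z<s)
  ... | d , d∈L , 0<fd = d , f≗pt
    where
    fd≡1 : f d ≡ 1
    fd≡1 = ≤-antisym (subst (f d ≤_) sum≡1 (listSum-term L f d∈L)) 0<fd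
    f≗pt : ∀ y → f y ≡ pt d y
    f≗pt y with d ≟ y
    ... | yes refl = fd≡1
    ... | no  d≢y with y ∈? L
    ...   | no  y∉L = off-L y y∉L
    ...   | yes y∈L = n≤0⇒n≡0 (+-cancelˡ-≤ 1 _ _
              (subst (λ t → t + f y ≤ 1) fd≡1 (subst (f d + f y ≤_) sum≡1 (listSum-two-terms L f d∈L y∈L d≢y))))

  sumFin-pt-injective : ∀ k (m : Fin k → A) → Injective _≡_ _≡_ m → ∀ y → sumFin k (λ x → pt (m x) y) ≤ 1
  sumFin-pt-injective zero    m inj y = z≤n
  sumFin-pt-injective (suc k) m inj y with m zero ≟ y
  ... | yes m₀≡y = ≤-reflexive (cong suc (sumFin-zero k (λ x → pt-elsewhere (m[suc]≢y x))))
    where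
    m[suc]≢y : ∀ x → m (suc x) ≢ y
    m[suc]≢y x m[suc]≡y with inj (trans m₀≡y (sym m[suc]≡y))
    ... | ()
  ... | no  _    = sumFin-pt-injective k (m ∘ suc) (FP.suc-injective ∘ inj) y

  sumsTo-pointMasses : ∀ n (ds : Fin n → A) (f : A → ℕ) → (∀ y → f y ≡ sumFin n (λ i → pt (ds i) y)) →
                       SumsTo f n
  sumsTo-pointMasses n ds f f≡ = L , uniq , off-L , sum≡n
    where
    L : List A
    L = deduplicate _≟_ (tabulate ds)
    uniq : Unique L
    uniq = deduplicate-! _≟_ (tabulate ds)
    ds∈L : ∀ i → ds i ∈ L
    ds∈L i = ∈-deduplicate⁺ _≟_ (∈-tabulate⁺ i)
    off-L : ∀ y → y ∉ L → f y ≡ 0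
    off-L y y∉L = trans (f≡ y) (sumFin-zero n (λ i → pt-elsewhere (λ dsi≡y → y∉L (subst (_∈ L) dsi≡y (ds∈L i)))))
    sum≡n : listSum L f ≡ n
    sum≡n = begin
      listSum L f                                  ≡⟨ listSum-cong L f≡ ⟩
      listSum L (λ y → sumFin n (λ i → pt (ds i) y)) ≡⟨ listSum-sumFin L n (pt ∘ ds) ⟩
      sumFin n (λ i → listSum L (pt (ds i)))       ≡⟨ sumFin-cong n (λ i → listSum-pt-∈ (ds i) L uniq (ds∈L i)) ⟩
      sumFin n (λ _ → 1)                           ≡⟨ sumFin-ones n ⟩
      n                                            ∎
      where open ≡-Reasoning

-- The orbit is finite, and its set of points is decidable, closed under the map and
-- under preimages; this is what the Kempe-chain swap below needs.
module Orbit {k : ℕ} (next : Fin k → Maybe (Fin k))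
             (next-injective : ∀ {x x′ y} → next x ≡ just y → next x′ ≡ just y → x ≡ x′)
             (start : Fin k) (start-unreachable : ∀ {x} → next x ≢ just start) where

  walk : ℕ → Maybe (Fin k)
  walk zero    = just start
  walk (suc t) = walk t >>= next

  walk-step : ∀ t {y} → walk (suc t) ≡ just y → Σ (Fin k) λ w → walk t ≡ just w × next w ≡ just y
  walk-step t = step (walk t)
    where
    step : ∀ m {y} → (m >>= next) ≡ just y → Σ (Fin k) λ w → m ≡ just w × next w ≡ just y
    step (just w) next-w≡y = w , refl , next-w≡y

  never-back-to-start : ∀ t → walk (suc t) ≢ just start
  never-back-to-start t walk≡start = start-unreachable (proj₂ (proj₂ (walk-step t walk≡start)))

  walk-injective : ∀ s t {x} → walk s ≡ just x → walk t ≡ just x → s ≡ t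
  walk-injective zero    zero    _  _  = refl
  walk-injective zero    (suc t) refl e = ⊥-elim (never-back-to-start t e)
  walk-injective (suc s) zero    e refl = ⊥-elim (never-back-to-start s e)
  walk-injective (suc s) (suc t) e e′ with walk-step s e | walk-step t e′
  ... | w , walk-s , next-w | w′ , walk-t , next-w′ =
    cong suc (walk-injective s t walk-s (subst (λ z → walk t ≡ just z) (next-injective next-w′ next-w) walk-t))

  walk-prefix : ∀ m t {y} → walk (m + t) ≡ just y → Σ (Fin k) λ z → walk t ≡ just z
  walk-prefix zero    t {y} e = y , e
  walk-prefix (suc m) t e = walk-prefix m t (proj₁ (proj₂ (walk-step (m + t) e)))

  -- If the walk lasts k steps, all times 0 … k are visited: k + 1 points of Fin k.
  visited-if-long : ∀ {y} → walk k ≡ just y → (t : Fin (suc k)) → Σ (Fin k) λ z → walk (toℕ t) ≡ just z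
  visited-if-long {y} walk-k≡y t =
    walk-prefix (k ∸ toℕ t) (toℕ t) (subst (λ s → walk s ≡ just y) (sym (m∸n+n≡m (FP.toℕ≤pred[n] t))) walk-k≡y)

  -- The orbit has at most k points, so its k-th point does not exist.
  walk-ends : ∀ {y} → walk k ≢ just y
  walk-ends walk-k≡y with FP.pigeonhole (n<1+n k) (proj₁ ∘ visited-if-long walk-k≡y)
  ... | i , j , i<j , same = <-irrefl (walk-injective (toℕ i) (toℕ j) (proj₂ (visited i)) walk-j) i<j
    where
    visited : (t : Fin (suc k)) → Σ (Fin k) λ z → walk (toℕ t) ≡ just z
    visited = visited-if-long walk-k≡y
    walk-j : walk (toℕ j) ≡ just (proj₁ (visited i))
    walk-j = subst (λ z → walk (toℕ j) ≡ just z) (sym same) (proj₂ (visited j))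

  -- x lies on the orbit (within its first k + 1 steps, which by walk-ends is all of it).
  OnOrbit : Fin k → Set
  OnOrbit x = Σ (Fin (suc k)) λ t → walk (toℕ t) ≡ just x

  onOrbit? : ∀ x → Dec (OnOrbit x)
  onOrbit? x = FP.any? (λ t → ≡-dec FP._≟_ (walk (toℕ t)) (just x))

  onOrbit-at : ∀ t {x} → t ≤ k → walk t ≡ just x → OnOrbit x
  onOrbit-at t t≤k e = fromℕ< (s≤s t≤k) , subst (λ s → walk s ≡ just _) (sym (FP.toℕ-fromℕ< (s≤s t≤k))) e

  start-onOrbit : OnOrbit start
  start-onOrbit = zero , refl

  onOrbit-forward : ∀ {x y} → OnOrbit x → next x ≡ just y → OnOrbit y
  onOrbit-forward {x} {y} (t , walk-t) next-x = onOrbit-at (suc (toℕ t)) t<k walk-suc-t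
    where
    walk-suc-t : walk (suc (toℕ t)) ≡ just y
    walk-suc-t = subst (λ m → (m >>= next) ≡ just y) (sym walk-t) next-x
    t<k : toℕ t < k
    t<k = ≤∧≢⇒< (FP.toℕ≤pred[n] t) (λ t≡k → walk-ends (subst (λ s → walk s ≡ just x) t≡k walk-t))

  onOrbit-backward : ∀ {x y} → OnOrbit y → next x ≡ just y → OnOrbit x
  onOrbit-backward (t , walk-t) = backward (toℕ t) (FP.toℕ≤pred[n] t) walk-t
    where
    backward : ∀ s {x y} → s ≤ k → walk s ≡ just y → next x ≡ just y → OnOrbit x
    backward zero    _   refl   next-x = ⊥-elim (start-unreachable next-x)
    backward (suc s) s<k walk-s next-x with walk-step s walk-s
    ... | w , walk-w , next-w = onOrbit-at s (<⇒≤ s<k) (subst (λ z → walk s ≡ just z) (next-injective next-w next-x) walk-w)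

  onOrbit-origin : ∀ {x} → OnOrbit x → x ≡ start ⊎ Σ (Fin k) λ w → next w ≡ just x
  onOrbit-origin (t , walk-t) = origin (toℕ t) walk-t
    where
    origin : ∀ s {x} → walk s ≡ just x → x ≡ start ⊎ Σ (Fin k) λ w → next w ≡ just x
    origin zero    refl   = inj₁ refl
    origin (suc s) walk-s = inj₂ (proj₁ (walk-step s walk-s) , proj₂ (proj₂ (walk-step s walk-s)))

transpose-cases : ∀ {n} (a b i : Fin n) →
                  (i ≡ a × PC.transpose a b i ≡ b) ⊎ (i ≡ b × PC.transpose a b i ≡ a) ⊎ PC.transpose a b i ≡ i
transpose-cases a b i with i FP.≟ a
... | yes i≡a = inj₁ (i≡a , refl)
... | no  _ with i FP.≟ b
...   | yes i≡b = inj₂ (inj₁ (i≡b , refl))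
...   | no  _   = inj₂ (inj₂ refl)

transpose-left : ∀ {n} (a b : Fin n) → PC.transpose a b a ≡ b
transpose-left a b with a FP.≟ a
... | yes _   = refl
... | no  a≢a = ⊥-elim (a≢a refl)

-- Edge colourings of a bipartite multigraph between rows Fin k and columns D with n colours.
-- Q i x = just d means that the edge of colour i at row x goes to column d.
module Colourings {D : Set} (_≟_ : DecidableEquality D) (n k : ℕ) where

  open PointMass _≟_

  Colouring : Set
  Colouring = Fin n → Fin k → Maybe D

  Proper : Colouring → Set
  Proper Q = ∀ i x y d → Q i x ≡ just d → Q i y ≡ just d → x ≡ y

  hit : Maybe D → D → ℕ
  hit nothing  = λ _ → 0
  hit (just d) = pt d

  count : Colouring → Fin k → D → ℕ
  count Q x d = sumFin n (λ i → hit (Q i x) d)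

  edge : Fin k → D → Fin k → D → ℕ
  edge α β x d with x FP.≟ α
  ... | yes _ = pt β d
  ... | no  _ = 0

  edge-on : ∀ α β d → edge α β α d ≡ pt β d
  edge-on α β d with α FP.≟ α
  ... | yes _   = refl
  ... | no  α≢α = ⊥-elim (α≢α refl)

  edge-off : ∀ {α x} β d → x ≢ α → edge α β x d ≡ 0
  edge-off {α} {x} β d x≢α with x FP.≟ α
  ... | yes x≡α = ⊥-elim (x≢α x≡α)
  ... | no  _   = refl

  insert : Colouring → Fin n → Fin k → D → Colouring
  insert Q a α β i x with i FP.≟ a | x FP.≟ α
  ... | yes _ | yes _ = just β
  ... | _     | _     = Q i x

  insert-slot : ∀ Q a α β → insert Q a α β a α ≡ just β
  insert-slot Q a α β with a FP.≟ a | α FP.≟ α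
  ... | yes _   | yes _   = refl
  ... | no  a≢a | _       = ⊥-elim (a≢a refl)
  ... | yes _   | no  α≢α = ⊥-elim (α≢α refl)

  insert-other-colour : ∀ Q {a i} α β x → i ≢ a → insert Q a α β i x ≡ Q i x
  insert-other-colour Q {a} {i} α β x i≢a with i FP.≟ a
  ... | yes i≡a = ⊥-elim (i≢a i≡a)
  ... | no  _   = refl

  insert-other-row : ∀ Q a {α} β i {x} → x ≢ α → insert Q a α β i x ≡ Q i x
  insert-other-row Q a {α} β i {x} x≢α with i FP.≟ a | x FP.≟ α
  ... | _     | yes x≡α = ⊥-elim (x≢α x≡α)
  ... | yes _ | no  _   = refl
  ... | no  _ | no  _   = refl

  insert-proper : ∀ Q a α β → Proper Q → (∀ x → Q a x ≢ just β) → Proper (insert Q a α β)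
  insert-proper Q a α β proper a-free i x y d e e′ with i FP.≟ a | x FP.≟ α | y FP.≟ α
  ... | yes refl | yes refl | yes refl = refl
  ... | yes refl | yes refl | no  _    = ⊥-elim (a-free y (trans e′ (sym e)))
  ... | yes refl | no  _    | yes refl = ⊥-elim (a-free x (trans e (sym e′)))
  ... | yes refl | no  _    | no  _    = proper i x y d e e′
  ... | no  _    | _        | _        = proper i x y d e e′

  insert-count : ∀ Q a α β → Q a α ≡ nothing → ∀ x d → Dec (x ≡ α) →
                 count (insert Q a α β) x d ≡ count Q x d + edge α β x d
  insert-count Q a α β a-free x d (no x≢α) = begin
    count (insert Q a α β) x d ≡⟨ sumFin-cong n (λ i → cong (λ m → hit m d) (insert-other-row Q a β i x≢α)) ⟩
    count Q x d                ≡⟨ +-identityʳ _ ⟨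
    count Q x d + 0            ≡⟨ cong (count Q x d +_) (edge-off β d x≢α) ⟨
    count Q x d + edge α β x d ∎
    where open ≡-Reasoning
  insert-count Q a α β a-free α d (yes refl) = begin
    count (insert Q a α β) α d ≡⟨ sumFin-update n _ _ a (pt β d) at-a elsewhere ⟩
    count Q α d + pt β d       ≡⟨ cong (count Q α d +_) (edge-on α β d) ⟨
    count Q α d + edge α β α d ∎
    where
    open ≡-Reasoning
    at-a : hit (insert Q a α β a α) d ≡ hit (Q a α) d + pt β d
    at-a = trans (cong (λ m → hit m d) (insert-slot Q a α β)) (cong (λ m → hit m d + pt β d) (sym a-free))
    elsewhere : ∀ i → i ≢ a → hit (insert Q a α β i α) d ≡ hit (Q i α) d
    elsewhere i i≢a = cong (λ m → hit m d) (insert-other-colour Q α β α i≢a)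

  _≟M_ : DecidableEquality (Maybe D)
  _≟M_ = ≡-dec _≟_

  -- Exchanging colours a and b on all rows of the a/b-alternating path that starts at r₀
  -- keeps the colouring proper and the counts unchanged, and frees colour a at β.
  module KempeSwap (Q : Colouring) (proper : Proper Q) (a b : Fin n) (β : D)
                   (r₀ : Fin k) (Q-a-r₀ : Q a r₀ ≡ just β) (b-free : ∀ x → Q b x ≢ just β) where

    a-row : D → Maybe (Fin k)
    a-row d with FP.any? (λ y → Q a y ≟M just d)
    ... | yes (y , _) = just y
    ... | no  _       = nothing

    a-row-sound : ∀ d {y} → a-row d ≡ just y → Q a y ≡ just d
    a-row-sound d e with FP.any? (λ y → Q a y ≟M just d)
    ... | yes (y , Q-a-y) = subst (λ z → Q a z ≡ just d) (just-injective e) Q-a-y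

    a-row-complete : ∀ {d y} → Q a y ≡ just d → a-row d ≡ just y
    a-row-complete {d} {y} Q-a-y with FP.any? (λ y → Q a y ≟M just d)
    ... | yes (y′ , Q-a-y′) = cong just (proper a y′ y d Q-a-y′ Q-a-y)
    ... | no  none          = ⊥-elim (none (y , Q-a-y))

    -- The next row on the alternating path: along the colour-b edge of x to a column,
    -- then back along the colour-a edge at that column.
    next : Fin k → Maybe (Fin k)
    next x = Q b x >>= a-row

    next-sound : ∀ x {y} → next x ≡ just y → Σ D λ d → Q b x ≡ just d × Q a y ≡ just d
    next-sound x = sound (Q b x)
      where
      sound : ∀ m {y} → (m >>= a-row) ≡ just y → Σ D λ d → m ≡ just d × Q a y ≡ just d
      sound (just d) e = d , refl , a-row-sound d e

    next-complete : ∀ {x y d} → Q b x ≡ just d → Q a y ≡ just d → next x ≡ just y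
    next-complete {y = y} Q-b-x Q-a-y = subst (λ m → (m >>= a-row) ≡ just y) (sym Q-b-x) (a-row-complete Q-a-y)

    next-injective : ∀ {x x′ y} → next x ≡ just y → next x′ ≡ just y → x ≡ x′
    next-injective {x} {x′} e e′ with next-sound x e | next-sound x′ e′
    ... | d , Q-b-x , Q-a-y | d′ , Q-b-x′ , Q-a-y′ =
      proper b x x′ d Q-b-x (trans Q-b-x′ (trans (sym Q-a-y′) Q-a-y))

    r₀-unreachable : ∀ {x} → next x ≢ just r₀
    r₀-unreachable {x} e with next-sound x e
    ... | d , Q-b-x , Q-a-r₀′ = b-free x (trans Q-b-x (trans (sym Q-a-r₀′) Q-a-r₀))

    open Orbit next next-injective r₀ r₀-unreachable

    swapped : Colouring
    swapped i x with onOrbit? x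
    ... | yes _ = Q (PC.transpose a b i) x
    ... | no  _ = Q i x

    swapped-count : ∀ x d → count swapped x d ≡ count Q x d
    swapped-count x d with onOrbit? x
    ... | yes _ = sumFin-transpose n a b (λ j → hit (Q j x) d)
    ... | no  _ = refl

    -- An edge on the path and an edge off the path never share colour and column,
    -- because the path is closed under both directions of the alternation.
    on-off-disjoint : ∀ i {x y d} → OnOrbit x → ¬ OnOrbit y →
                      Q (PC.transpose a b i) x ≡ just d → Q i y ≡ just d → x ≡ y
    on-off-disjoint i {x} {y} {d} on-x off-y e e′ with transpose-cases a b i
    ... | inj₁ (refl , τi≡b)        =
      ⊥-elim (off-y (onOrbit-forward on-x (next-complete (subst (λ c → Q c x ≡ just d) τi≡b e) e′)))
    ... | inj₂ (inj₁ (refl , τi≡a)) =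
      ⊥-elim (off-y (onOrbit-backward on-x (next-complete e′ (subst (λ c → Q c x ≡ just d) τi≡a e))))
    ... | inj₂ (inj₂ τi≡i)          = proper i x y d (subst (λ c → Q c x ≡ just d) τi≡i e) e′

    swapped-proper : Proper swapped
    swapped-proper i x y d e e′ with onOrbit? x | onOrbit? y
    ... | yes _    | yes _    = proper (PC.transpose a b i) x y d e e′
    ... | no  _    | no  _    = proper i x y d e e′
    ... | yes on-x | no off-y = on-off-disjoint i on-x off-y e e′
    ... | no off-x | yes on-y = sym (on-off-disjoint i on-y off-x e′ e)

    -- Rows on the path use colour a (the start by hypothesis, later rows by construction),
    -- so a row where colour a is free is off the path and stays free.
    path-uses-a : ∀ {x} → OnOrbit x → Σ D λ d → Q a x ≡ just d
    path-uses-a on-x with onOrbit-origin on-x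
    ... | inj₁ refl    = β , Q-a-r₀
    ... | inj₂ (w , e) = let d , _ , Q-a-x = next-sound w e in d , Q-a-x

    swapped-keeps-free : ∀ {α} → Q a α ≡ nothing → swapped a α ≡ nothing
    swapped-keeps-free {α} a-free with onOrbit? α
    ... | no  _    = a-free
    ... | yes on-α with trans (sym a-free) (proj₂ (path-uses-a on-α))
    ...   | ()

    swapped-a-free : ∀ x → swapped a x ≢ just β
    swapped-a-free x e with onOrbit? x
    ... | yes _     = b-free x (subst (λ c → Q c x ≡ just β) (transpose-left a b) e)
    ... | no  off-x = off-x (subst OnOrbit (proper a r₀ x β Q-a-r₀ e) start-onOrbit)

  add-edge : ∀ Q → Proper Q → ∀ a b α β → Q a α ≡ nothing → (∀ x → Q b x ≢ just β) →
             Σ Colouring λ Q′ → Proper Q′ × (∀ x d → count Q′ x d ≡ count Q x d + edge α β x d)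
  add-edge Q proper a b α β a-free-α b-free-β with FP.any? (λ y → Q a y ≟M just β)
  ... | no  a-unused =
    insert Q a α β , insert-proper Q a α β proper (λ x e → a-unused (x , e)) ,
    λ x d → insert-count Q a α β a-free-α x d (x FP.≟ α)
  ... | yes (r₀ , Q-a-r₀) =
    insert swapped a α β , insert-proper swapped a α β swapped-proper swapped-a-free ,
    λ x d → trans (insert-count swapped a α β (swapped-keeps-free a-free-α) x d (x FP.≟ α))
                  (cong (_+ edge α β x d) (swapped-count x d))
    where open KempeSwap Q proper a b β r₀ Q-a-r₀ b-free-β

  free-at-row : ∀ Q x (L : List D) → (∀ i d → Q i x ≡ just d → d ∈ L) → listSum L (count Q x) < n →
                ∃[ a ] Q a x ≡ nothing
  free-at-row Q x L in-L sum<n with sumFin-<-zero-term n (λ i → listSum L (hit (Q i x)))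
                                       (subst (_< n) (listSum-sumFin L n (λ i → hit (Q i x))) sum<n)
  ... | a , massless = a , unused (Q a x) (in-L a) massless
    where
    unused : ∀ m → (∀ d → m ≡ just d → d ∈ L) → listSum L (hit m) ≡ 0 → m ≡ nothing
    unused nothing  _    _      = refl
    unused (just d) in-L′ mass≡0 with subst (1 ≤_) mass≡0
                                        (subst (_≤ listSum L (pt d)) (pt-self d) (listSum-term L (pt d) (in-L′ d refl)))
    ... | ()

  free-at-column : ∀ Q β → sumFin k (λ x → count Q x β) < n → ∃[ b ] ∀ x → Q b x ≢ just β
  free-at-column Q β sum<n with sumFin-<-zero-term n (λ i → sumFin k (λ x → hit (Q i x) β))
                                  (subst (_< n) (sumFin-comm k n (λ x i → hit (Q i x) β)) sum<n)
  ... | b , massless = b , b-free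
    where
    b-free : ∀ x → Q b x ≢ just β
    b-free x e with subst₂ _≤_ (trans (cong (λ m → hit m β) e) (pt-self β)) massless
                      (sumFin-term k (λ x → hit (Q b x) β) x)
    ... | ()

  full-row-total : ∀ Q x (L : List D) → Unique L → listSum L (count Q x) ≡ n → ∀ i → Σ D λ d → Q i x ≡ just d
  full-row-total Q x L uniq sum≡n i = used (Q i x) (sumFin-all-ones n (λ j → at-most-one (Q j x)) total i)
    where
    total : sumFin n (λ j → listSum L (hit (Q j x))) ≡ n
    total = trans (sym (listSum-sumFin L n (λ j → hit (Q j x)))) sum≡n
    at-most-one : ∀ m → listSum L (hit m) ≤ 1
    at-most-one nothing  = ≤-trans (≤-reflexive (listSum-zero L (λ _ → refl))) z≤n
    at-most-one (just d) = listSum-pt-≤1 d L uniq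
    used : ∀ m → listSum L (hit m) ≡ 1 → Σ D λ d → m ≡ just d
    used nothing  mass≡1 with trans (sym (listSum-zero L (λ _ → refl))) mass≡1
    ... | ()
    used (just d) _      = d , refl

module König {D : Set} (_≟_ : DecidableEquality D) (n k : ℕ) (L : Fin k → List D) where

  open PointMass _≟_
  open Colourings _≟_ n k
  open DecMembership _≟_ using (_∈?_)

  Matrix : Set
  Matrix = Fin k → D → ℕ

  record Bounded (G : Matrix) : Set where
    field
      support      : ∀ x d → d ∉ L x → G x d ≡ 0
      row-bound    : ∀ x → listSum (L x) (G x) ≤ n
      column-bound : ∀ d → sumFin k (λ x → G x d) ≤ n
  open Bounded

  Decomposition : Matrix → Set
  Decomposition G = Σ Colouring λ Q → Proper Q × (∀ x d → count Q x d ≡ G x d)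

  -- The total mass of G; it decreases when an edge is removed and drives the induction.
  mass : Matrix → ℕ
  mass G = sumFin k (λ x → listSum (L x) (G x))

  bounded-mono : ∀ {G G′} → (∀ x d → G′ x d ≤ G x d) → Bounded G → Bounded G′
  bounded-mono G′≤G bounded = record
    { support      = λ x d d∉ → n≤0⇒n≡0 (subst (_ ≤_) (support bounded x d d∉) (G′≤G x d))
    ; row-bound    = λ x → ≤-trans (listSum-mono (L x) (G′≤G x)) (row-bound bounded x)
    ; column-bound = λ d → ≤-trans (sumFin-mono k (λ x → G′≤G x d)) (column-bound bounded d)
    }

  massless-decomposition : ∀ G → Bounded G → mass G ≡ 0 → Decomposition G
  massless-decomposition G bounded mass≡0 = (λ _ _ → nothing) , (λ _ _ _ _ ()) ,
    λ x d → trans (sumFin-zero n (λ _ → refl)) (sym (G≡0 x d))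
    where
    G≡0 : ∀ x d → G x d ≡ 0
    G≡0 x d with d ∈? L x
    ... | no  d∉ = support bounded x d d∉
    ... | yes d∈ = n≤0⇒n≡0 (subst (G x d ≤_) mass≡0
                     (≤-trans (listSum-term (L x) (G x) d∈) (sumFin-term k (λ x → listSum (L x) (G x)) x)))

  positive-entry : ∀ G → 0 < mass G → Σ (Fin k) λ α → Σ D λ β → β ∈ L α × 0 < G α β
  positive-entry G 0<mass =
    let α , 0<row = sumFin-positive-term k (λ x → listSum (L x) (G x)) 0<mass
        β , β∈ , 0<entry = listSum-positive-term (L α) (G α) 0<row
    in α , β , β∈ , 0<entry

  module RemoveEdge (G : Matrix) (α : Fin k) (β : D) (β∈ : β ∈ L α) (0<Gαβ : 0 < G α β) where

    G′ : Matrix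
    G′ x d = G x d ∸ edge α β x d

    edge≤G : ∀ x d → edge α β x d ≤ G x d
    edge≤G x d with x FP.≟ α | β ≟ d
    ... | yes refl | yes refl = subst (_≤ G α β) (sym (pt-self β)) 0<Gαβ
    ... | yes _    | no  β≢d  = subst (_≤ G x d) (sym (pt-elsewhere β≢d)) z≤n
    ... | no  _    | _        = z≤n

    G′≤G : ∀ x d → G′ x d ≤ G x d
    G′≤G x d = m∸n≤m (G x d) (edge α β x d)

    G′<G : G′ α β < G α β
    G′<G = subst (λ e → G α β ∸ e < G α β) (sym (trans (edge-on α β β) (pt-self β))) (∸-monoʳ-< z<s 0<Gαβ)

    restore : ∀ x d → G′ x d + edge α β x d ≡ G x d
    restore x d = m∸n+n≡m (edge≤G x d)

    row-lower : listSum (L α) (G′ α) < listSum (L α) (G α)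
    row-lower = listSum-strict (L α) (G′≤G α) β∈ G′<G

    column-lower : sumFin k (λ x → G′ x β) < sumFin k (λ x → G x β)
    column-lower = sumFin-strict k (λ x → G′≤G x β) α G′<G

    mass-lower : mass G′ < mass G
    mass-lower = sumFin-strict k (λ x → listSum-mono (L x) (G′≤G x)) α row-lower

    -- A decomposition of G′ extends to one of G: row α and column β of G′ are below n,
    -- so they have free colours, and König's exchange step adds the edge.
    extend : Bounded G → Decomposition G′ → Decomposition G
    extend bounded (Q′ , proper′ , counts′) =
      let a , a-free = free-at-row Q′ α (L α) in-support (begin-strict
            listSum (L α) (count Q′ α) ≡⟨ listSum-cong (L α) (counts′ α) ⟩
            listSum (L α) (G′ α)       <⟨ row-lower ⟩
            listSum (L α) (G α)        ≤⟨ row-bound bounded α ⟩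
            n                          ∎)
          b , b-free = free-at-column Q′ β (begin-strict
            sumFin k (λ x → count Q′ x β) ≡⟨ sumFin-cong k (λ x → counts′ x β) ⟩
            sumFin k (λ x → G′ x β)       <⟨ column-lower ⟩
            sumFin k (λ x → G x β)        ≤⟨ column-bound bounded β ⟩
            n                             ∎)
          Q , proper , counts = add-edge Q′ proper′ a b α β a-free b-free
      in Q , proper , λ x d → trans (counts x d) (trans (cong (_+ edge α β x d) (counts′ x d)) (restore x d))
      where
      open ≤-Reasoning
      -- Every colour used at row α goes to a column in L α, since G′ vanishes elsewhere.
      in-support : ∀ i d → Q′ i α ≡ just d → d ∈ L α
      in-support i d e with d ∈? L α
      ... | yes d∈ = d∈
      ... | no  d∉ with subst₂ _≤_ (trans (cong (λ m → hit m d) e) (pt-self d))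
                                   (trans (counts′ α d) (support (bounded-mono G′≤G bounded) α d d∉))
                                   (sumFin-term n (λ j → hit (Q′ j α) d) i)
      ...   | ()

  decompose : ∀ N G → mass G ≤ N → Bounded G → Decomposition G
  decompose N G mass≤N bounded with mass G ≟ℕ 0
  ... | yes mass≡0 = massless-decomposition G bounded mass≡0
  decompose zero    G mass≤0 bounded | no mass≢0 = ⊥-elim (mass≢0 (n≤0⇒n≡0 mass≤0))
  decompose (suc N) G mass≤N bounded | no mass≢0 =
    let α , β , β∈ , 0<Gαβ = positive-entry G (n≢0⇒n>0 mass≢0)
        open RemoveEdge G α β β∈ 0<Gαβ
    in extend bounded (decompose N G′ (≤-pred (≤-trans mass-lower mass≤N)) (bounded-mono G′≤G bounded))

module Histograms {D : Set} (_≟_ : DecidableEquality D) where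

  open PointMass _≟_

  matching-simple : ∀ S (m : Fin (card S) → D) → Injective _≡_ _≡_ m → IsSimple S (λ α → pt (m α))
  matching-simple S m m-injective = (λ α → pt-sumsTo-1 (m α)) , sumFin-pt-injective (card S) m m-injective

  -- A histogram of degree n is König-decomposed into n colour classes; since every row has
  -- mass exactly n, each colour class is a perfect matching, hence a simple histogram.
  histogram⇒sum : ∀ S n H → IsHistogram S H n → SumOfSimple S H n
  histogram⇒sum S n H (rows , columns) =
    (λ i α → pt (m i α)) , (λ i → matching-simple S (m i) (m-injective i)) , H≡
    where
    k : ℕ
    k = card S
    L : Fin k → List D
    L α = proj₁ (rows α)
    open Colourings _≟_ n k
    open König _≟_ n k L
    bounded : Bounded H
    bounded = record
      { support      = λ α → proj₁ (proj₂ (proj₂ (rows α)))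
      ; row-bound    = λ α → ≤-reflexive (proj₂ (proj₂ (proj₂ (rows α))))
      ; column-bound = columns
      }
    decomposition : Decomposition H
    decomposition = decompose (mass H) H ≤-refl bounded
    Q : Colouring
    Q = proj₁ decomposition
    proper : Proper Q
    proper = proj₁ (proj₂ decomposition)
    counts : ∀ α β → count Q α β ≡ H α β
    counts = proj₂ (proj₂ decomposition)
    total : ∀ i α → Σ D λ d → Q i α ≡ just d
    total i α = full-row-total Q α (L α) (proj₁ (proj₂ (rows α)))
                  (trans (listSum-cong (L α) (counts α)) (proj₂ (proj₂ (proj₂ (rows α))))) i
    m : Fin n → Fin k → D
    m i α = proj₁ (total i α)
    m-injective : ∀ i → Injective _≡_ _≡_ (m i)
    m-injective i {α} {α′} mα≡mα′ = proper i α α′ (m i α)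
      (proj₂ (total i α)) (trans (proj₂ (total i α′)) (cong just (sym mα≡mα′)))
    H≡ : ∀ α β → H α β ≡ sumFin n (λ i → pt (m i α) β)
    H≡ α β = trans (sym (counts α β)) (sumFin-cong n (λ i → cong (λ c → hit c β) (proj₂ (total i α))))

  -- Conversely each row of a simple histogram is a unit mass, so a row of a sum of n simple
  -- histograms is a sum of n unit masses, and each column gains at most 1 per summand.
  sum⇒histogram : ∀ S n H → SumOfSimple S H n → IsHistogram S H n
  sum⇒histogram S n H (Hs , simple , H≡) = rows , columns
    where
    k : ℕ
    k = card S
    unit : ∀ i α → Σ D λ d → ∀ β → Hs i α β ≡ pt d β
    unit i α = sumsTo-1⇒pt (Hs i α) (proj₁ (simple i) α)
    rows : ∀ α → SumsTo (H α) n
    rows α = sumsTo-pointMasses n (λ i → proj₁ (unit i α)) (H α)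
               (λ β → trans (H≡ α β) (sumFin-cong n (λ i → proj₂ (unit i α) β)))
    columns : ∀ β → sumFin k (λ α → H α β) ≤ n
    columns β = begin
      sumFin k (λ α → H α β)                     ≡⟨ sumFin-cong k (λ α → H≡ α β) ⟩
      sumFin k (λ α → sumFin n (λ i → Hs i α β)) ≡⟨ sumFin-comm k n (λ α i → Hs i α β) ⟩
      sumFin n (λ i → sumFin k (λ α → Hs i α β)) ≤⟨ sumFin-≤-ones n (λ i → proj₂ (simple i) β) ⟩
      n                                          ∎
      where open ≤-Reasoning

theorem3 : {D : Set} → Countable D → (S : FinSubset D) → (n : ℕ) → (H : Fun S) →
             IsHistogram S H n ⇔ SumOfSimple S H n
theorem3 C S n H = mk⇔ (histogram⇒sum S n H) (sum⇒histogram S n H)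
  where open Histograms (eq? (mk↣ (Countable.enc-inj C)))
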